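{- Let $\mathcal X=(X,e,\le,R)$ be a CK-frame and $A\in\{N_\Diamond, C_\Diamond, I_{\Diamond\Box}\}$. If $\mathcal X$ satisfies ($A$-suff), then $\mathcal X$ validates $A$.
   Context: Axioms: $N_\Diamond$: $\Diamond\bot\to\bot$; $C_\Diamond$: $\Diamond(p\vee q)\to\Diamond p\vee\Diamond q$; $I_{\Diamond\Box}$: $(\Diamond p\to\Box q)\to\Box(p\to q)$, where formulas are built from propositional variables, $\bot,\wedge,\vee,\to,\Box,\Diamond$. A CK-frame is $(X,e,\le,R)$ with $(X,\le)$ a preorder, $e\in X$ such that $e\le y$ implies $y=e$, and $R\subseteq X\times X$ such that $eRx$ iff $x=e$. A valuation maps each variable to an upset of $(X,\le)$ containing $e$. Forcing: $x\Vdash p$ iff $x\in V(p)$; $x\Vdash\bot$ iff $x=e$; $\wedge,\vee$ pointwise; $x\Vdash\varphi\to\psi$ iff for all $y\ge x$, $y\Vdash\varphi$ implies $y\Vdash\psi$; $x\Vdash\Box\varphi$ iff for all $y,z$ with $x\le y$ and $yRz$, $z\Vdash\varphi$; $x\Vdash\Diamond\varphi$ iff for all $y\ge x$ there is $z$ with $yRz$ and $z\Vdash\varphi$. A frame validates a formula if it is forced at every world under every valuation. Conditions: ($N_\Diamond$-suff): $\forall x\,(xRe\Rightarrow x=e)$. ($C_\Diamond$-suff): $\forall x\,\exists x'\,(x\le x'$ and $\forall y,z\,(x\le y$ and $x'Rz\Rightarrow\exists w\,(yRw$ and $z\le w)))$. ($I_{\Diamond\Box}$-suff): for all $x,y,z$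 with $xRy$ and $y\le z$ there is $u$ with $x\le u$, $uRz$, and for all $s\ge u$ there is $t$ with $sRt$ and $z\le t$. -}

module Defs where

open import Data.Nat using (ℕ)
open import Data.Product using (Σ; _×_; _,_)
open import Data.Sum using (_⊎_)
open import Relation.Binary.PropositionalEquality using (_≡_)

data Form : Set where
  var  : ℕ → Form
  ⊥'   : Form
  _∧'_ : Form → Form → Form
  _∨'_ : Form → Form → Form
  _⇒_  : Form → Form → Form
  □    : Form → Form
  ◇    : Form → Form

infixr 5 _⇒_
infixr 6 _∨'_
infixr 7 _∧'_

record CKFrame : Set₁ where
  field
    X     : Set
    e     : X
    _≤_   : X → X → Set
    _R_   : X → X → Set
    ≤-refl  : ∀ {x} → x ≤ x
    ≤-trans : ∀ {x y z} → x ≤ y → y ≤ z → x ≤ z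
    e-≤-fallible : ∀ {y} → e ≤ y → y ≡ e
    e-R-only     : ∀ {x} → e R x → x ≡ e
    e-R-e        : e R e

record Valuation (F : CKFrame) : Set₁ where
  open CKFrame F
  field
    V      : ℕ → X → Set
    V-up   : ∀ p {x y} → x ≤ y → V p x → V p y
    V-e    : ∀ p → V p e

module _ (F : CKFrame) (M : Valuation F) where
  open CKFrame F
  open Valuation M

  _⊩_ : X → Form → Set
  x ⊩ var p   = V p x
  x ⊩ ⊥'      = x ≡ e
  x ⊩ (φ ∧' ψ) = (x ⊩ φ) × (x ⊩ ψ)
  x ⊩ (φ ∨' ψ) = (x ⊩ φ) ⊎ (x ⊩ ψ)
  x ⊩ (φ ⇒ ψ)  = ∀ y → x ≤ y → y ⊩ φ → y ⊩ ψ
  x ⊩ □ φ      = ∀ y z → x ≤ y → y R z → z ⊩ φ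
  x ⊩ ◇ φ      = ∀ y → x ≤ y → Σ X (λ z → (y R z) × (z ⊩ φ))

Validates : CKFrame → Form → Set₁
Validates F φ = ∀ (M : Valuation F) (x : CKFrame.X F) → _⊩_ F M x φ

p₀ q₀ : Form
p₀ = var 0
q₀ = var 1

N◇ C◇ I◇□ : Form
N◇  = ◇ ⊥' ⇒ ⊥'
C◇  = ◇ (p₀ ∨' q₀) ⇒ (◇ p₀ ∨' ◇ q₀)
I◇□ = (◇ p₀ ⇒ □ q₀) ⇒ □ (p₀ ⇒ q₀)

module _ (F : CKFrame) where
  open CKFrame F

  N◇-suff : Set
  N◇-suff = ∀ x → x R e → x ≡ e

  C◇-suff : Set
  C◇-suff = ∀ x → Σ X λ x' → (x ≤ x') ×
              (∀ y z → x ≤ y → x' R z → Σ X λ w → (y R w) × (z ≤ w))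

  I◇□-suff : Set
  I◇□-suff = ∀ x y z → x R y → y ≤ z →
               Σ X λ u → (x ≤ u) × (u R z) ×
                 (∀ s → u ≤ s → Σ X λ t → (s R t) × (z ≤ t))

data Axiom : Set where
  axN axC axI : Axiom

axiomForm : Axiom → Form
axiomForm axN = N◇
axiomForm axC = C◇
axiomForm axI = I◇□

axiomSuff : Axiom → CKFrame → Set
axiomSuff axN F = N◇-suff F
axiomSuff axC F = C◇-suff F
axiomSuff axI F = I◇□-suff F

{-# OPTIONS --safe #-}
module Submission where

open import Defs
open import Data.Product using (Σ; _×_; _,_)
open import Data.Sum using (inj₁; inj₂)
import Data.Sum as Sum
open import Relation.Binary.PropositionalEquality using (subst)

-- Forcing is persistent along ≤, so if every ≤-successor of u has an R-successor
-- above a world z forcing φ, then u forces ◇ φ.  (C◇-suff) and (I◇□-suff) supply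
-- such a pair u, z at the world where the axiom is checked, while (N◇-suff) says
-- that only the fallible world e sees e.

module _ (F : CKFrame) where
  open CKFrame F

  _⇝_ : X → X → Set
  u ⇝ z = ∀ s → u ≤ s → Σ X λ t → (s R t) × (z ≤ t)

  module _ (M : Valuation F) where
    open Valuation M

    ⊩-mono : ∀ φ {x y} → x ≤ y → _⊩_ F M x φ → _⊩_ F M y φ
    ⊩-mono (var p)   x≤y x⊩p              = V-up p x≤y x⊩p
    ⊩-mono ⊥'        x≤y x≡e              = e-≤-fallible (subst (_≤ _) x≡e x≤y)
    ⊩-mono (φ ∧' ψ)  x≤y (x⊩φ , x⊩ψ)      = ⊩-mono φ x≤y x⊩φ , ⊩-mono ψ x≤y x⊩ψ
    ⊩-mono (φ ∨' ψ)  x≤y (inj₁ x⊩φ)       = inj₁ (⊩-mono φ x≤y x⊩φ)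
    ⊩-mono (φ ∨' ψ)  x≤y (inj₂ x⊩ψ)       = inj₂ (⊩-mono ψ x≤y x⊩ψ)
    ⊩-mono (φ ⇒ ψ)   x≤y x⊩φ⇒ψ z y≤z      = x⊩φ⇒ψ z (≤-trans x≤y y≤z)
    ⊩-mono (□ φ)     x≤y x⊩□φ z w y≤z zRw = x⊩□φ z w (≤-trans x≤y y≤z) zRw
    ⊩-mono (◇ φ)     x≤y x⊩◇φ z y≤z       = x⊩◇φ z (≤-trans x≤y y≤z)

    ⊩◇-from-⇝ : ∀ φ {u z} → u ⇝ z → _⊩_ F M z φ → _⊩_ F M u (◇ φ)
    ⊩◇-from-⇝ φ u⇝z z⊩φ s u≤s with u⇝z s u≤s
    ... | t , sRt , z≤t = t , sRt , ⊩-mono φ z≤t z⊩φ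

  N◇-sound : N◇-suff F → Validates F N◇
  N◇-sound suff M x y x≤y y⊩◇⊥ with y⊩◇⊥ y ≤-refl
  ... | z , yRz , z≡e = suff y (subst (y R_) z≡e yRz)

  C◇-sound : C◇-suff F → ∀ φ ψ → Validates F (◇ (φ ∨' ψ) ⇒ ◇ φ ∨' ◇ ψ)
  C◇-sound suff φ ψ M x y x≤y y⊩◇φ∨ψ with suff y
  ... | y' , y≤y' , covers with y⊩◇φ∨ψ y' y≤y'
  ...   | z , y'Rz , z⊩φ∨ψ = Sum.map (⊩◇-from-⇝ M φ y⇝z) (⊩◇-from-⇝ M ψ y⇝z) z⊩φ∨ψ
    where
    y⇝z : y ⇝ z
    y⇝z s y≤s = covers s z y≤s y'Rz

  I◇□-sound : I◇□-suff F → ∀ φ ψ → Validates F ((◇ φ ⇒ □ ψ) ⇒ □ (φ ⇒ ψ))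
  I◇□-sound suff φ ψ M x y x≤y y⊩◇φ⇒□ψ y' z y≤y' y'Rz z' z≤z' z'⊩φ
    with suff y' z z' y'Rz z≤z'
  ... | u , y'≤u , uRz' , u⇝z' =
    y⊩◇φ⇒□ψ u (≤-trans y≤y' y'≤u) (⊩◇-from-⇝ M φ u⇝z' z'⊩φ) u z' ≤-refl uRz'

mainTheorem9 : (F : CKFrame) (A : Axiom) → axiomSuff A F → Validates F (axiomForm A)
mainTheorem9 F axN suff = N◇-sound F suff
mainTheorem9 F axC suff = C◇-sound F suff p₀ q₀
mainTheorem9 F axI suff = I◇□-sound F suff p₀ q₀
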